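{- Let $\mathcal{C}$ be a locally cartesian closed category with a model structure such that the cofibrations are exactly the monomorphisms, the pushout-product of a cofibration with a trivial cofibration is a trivial cofibration, and $I$ is a good (not necessarily very good) cylinder object for the terminal object with two disjoint endpoint inclusions $\{0\},\{1\}\colon1\rightrightarrows I$. Let $f\colon X\to Y$ be a map over an object $C$ between objects $X\to C$, $Y\to C$ that are fibrant in $\mathcal{C}/C$. Then the endpoint evaluation map $\mathrm{ev}_1\colon P^I_C(f)\to Y$ is a fibration. It is furthermore a trivial fibration if $f$ is a weak equivalence and the model structure is right proper.
   Context: For $Y\to C$, $P^I_C(Y):=[C\times I,Y]_C$ (local exponential in $\mathcal{C}/C$), with $\mathrm{ev}_\partial=(\mathrm{ev}_0,\mathrm{ev}_1)\colon P^I_C(Y)\to Y\times_C Y$ induced by $\{0\},\{1\}$. The fibred mapping path object $P^I_C(f)$ of $f\colon X\to Y$ over $C$ is the pullback of $\mathrm{ev}_\partial\colon P^I_C(Y)\to Y\times_CY$ along $f\times_CY\colon X\times_CY\to Y\times_CY$; it has evaluation maps $\mathrm{ev}_0\colon P^I_C(f)\to X$ and $\mathrm{ev}_1\colon P^I_C(f)\to Y$ (the composites of $P^I_C(f)\to X\times_CY$ with the two projections). "Good cylinder" means $1\sqcup1\to I$ is a cofibration and $I\to1$ a weak equivalence. -}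

module Defs where

open import Level using (Level; _⊔_) renaming (suc to lsuc)
open import Relation.Binary.PropositionalEquality
open import Data.Product using (Σ; _×_; _,_; proj₁; proj₂)

record Category (o ℓ : Level) : Set (lsuc (o ⊔ ℓ)) where
  infixr 9 _∘_
  infix 4 _⇒_
  field
    Obj : Set o
    _⇒_ : Obj → Obj → Set ℓ
    id : ∀ {A} → A ⇒ A
    _∘_ : ∀ {A B C} → B ⇒ C → A ⇒ B → A ⇒ C
    identityˡ : ∀ {A B} {f : A ⇒ B} → id ∘ f ≡ f
    identityʳ : ∀ {A B} {f : A ⇒ B} → f ∘ id ≡ f
    assoc : ∀ {A B C D} {f : A ⇒ B} {g : B ⇒ C} {h : C ⇒ D} →
            (h ∘ g) ∘ f ≡ h ∘ (g ∘ f)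

module CatDefs {o ℓ} (𝒞 : Category o ℓ) where
  open Category 𝒞

  Mono : ∀ {A B} → A ⇒ B → Set (o ⊔ ℓ)
  Mono {A} f = ∀ {Z} (g h : Z ⇒ A) → f ∘ g ≡ f ∘ h → g ≡ h

  IsTerminal : Obj → Set (o ⊔ ℓ)
  IsTerminal T = (A : Obj) → Σ (A ⇒ T) λ u → (v : A ⇒ T) → v ≡ u

  IsInitial : Obj → Set (o ⊔ ℓ)
  IsInitial I = (A : Obj) → Σ (I ⇒ A) λ u → (v : I ⇒ A) → v ≡ u

  IsPullback : ∀ {A B C P} (f : A ⇒ C) (g : B ⇒ C) (p₁ : P ⇒ A) (p₂ : P ⇒ B) → Set (o ⊔ ℓ)
  IsPullback {A} {B} {C} {P} f g p₁ p₂ =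
    (f ∘ p₁ ≡ g ∘ p₂) ×
    (∀ {Z} (h₁ : Z ⇒ A) (h₂ : Z ⇒ B) → f ∘ h₁ ≡ g ∘ h₂ →
      Σ (Z ⇒ P) λ u → ((p₁ ∘ u ≡ h₁) × (p₂ ∘ u ≡ h₂)) ×
        ((v : Z ⇒ P) → p₁ ∘ v ≡ h₁ → p₂ ∘ v ≡ h₂ → v ≡ u))

  IsPushout : ∀ {A B C Q} (f : C ⇒ A) (g : C ⇒ B) (q₁ : A ⇒ Q) (q₂ : B ⇒ Q) → Set (o ⊔ ℓ)
  IsPushout {A} {B} {C} {Q} f g q₁ q₂ =
    (q₁ ∘ f ≡ q₂ ∘ g) ×
    (∀ {Z} (h₁ : A ⇒ Z) (h₂ : B ⇒ Z) → h₁ ∘ f ≡ h₂ ∘ g →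
      Σ (Q ⇒ Z) λ u → ((u ∘ q₁ ≡ h₁) × (u ∘ q₂ ≡ h₂)) ×
        ((v : Q ⇒ Z) → v ∘ q₁ ≡ h₁ → v ∘ q₂ ≡ h₂ → v ≡ u))

  record Pullback {A B C} (f : A ⇒ C) (g : B ⇒ C) : Set (o ⊔ ℓ) where
    field
      P : Obj
      p₁ : P ⇒ A
      p₂ : P ⇒ B
      isPullback : IsPullback f g p₁ p₂
    commute : f ∘ p₁ ≡ g ∘ p₂
    commute = proj₁ isPullback
    pair : ∀ {Z} (h₁ : Z ⇒ A) (h₂ : Z ⇒ B) → f ∘ h₁ ≡ g ∘ h₂ → Z ⇒ P
    pair h₁ h₂ eq = proj₁ (proj₂ isPullback h₁ h₂ eq)
    p₁∘pair : ∀ {Z} {h₁ : Z ⇒ A} {h₂ : Z ⇒ B} (eq : f ∘ h₁ ≡ g ∘ h₂) → p₁ ∘ pair h₁ h₂ eq ≡ h₁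
    p₁∘pair {h₁ = h₁} {h₂} eq = proj₁ (proj₁ (proj₂ (proj₂ isPullback h₁ h₂ eq)))
    p₂∘pair : ∀ {Z} {h₁ : Z ⇒ A} {h₂ : Z ⇒ B} (eq : f ∘ h₁ ≡ g ∘ h₂) → p₂ ∘ pair h₁ h₂ eq ≡ h₂
    p₂∘pair {h₁ = h₁} {h₂} eq = proj₂ (proj₁ (proj₂ (proj₂ isPullback h₁ h₂ eq)))

  record Pushout {A B C} (f : C ⇒ A) (g : C ⇒ B) : Set (o ⊔ ℓ) where
    field
      Q : Obj
      q₁ : A ⇒ Q
      q₂ : B ⇒ Q
      isPushout : IsPushout f g q₁ q₂
    copair : ∀ {Z} (h₁ : A ⇒ Z) (h₂ : B ⇒ Z) → h₁ ∘ f ≡ h₂ ∘ g → Q ⇒ Z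
    copair h₁ h₂ eq = proj₁ (proj₂ isPushout h₁ h₂ eq)

  PullbackChoice : Set (o ⊔ ℓ)
  PullbackChoice = ∀ {A B C} (f : A ⇒ C) (g : B ⇒ C) → Pullback f g

  record IsRetract {A B A' B'} (f : A ⇒ B) (g : A' ⇒ B') : Set ℓ where
    field
      i : A ⇒ A'
      r : A' ⇒ A
      j : B ⇒ B'
      s : B' ⇒ B
      r∘i : r ∘ i ≡ id
      s∘j : s ∘ j ≡ id
      sq₁ : g ∘ i ≡ j ∘ f
      sq₂ : f ∘ r ≡ s ∘ g

  Lifts : ∀ {A B X Y} (i : A ⇒ B) (p : X ⇒ Y) → Set ℓ
  Lifts {A} {B} {X} {Y} i p =
    (u : A ⇒ X) (v : B ⇒ Y) → p ∘ u ≡ v ∘ i →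
      Σ (B ⇒ X) λ d → (d ∘ i ≡ u) × (p ∘ d ≡ v)

  -- Local exponentials: for a : A → C, y : Y → C, the exponential [A,Y]_C
  -- in 𝒞/C, given as a couniversal arrow ε : [A,Y]_C ×_C A → Y over C.

  module _ (pb : PullbackChoice) where
    liftMap : ∀ {C A Z E} (a : A ⇒ C) (z : Z ⇒ C) (e : E ⇒ C) (h : Z ⇒ E) →
              e ∘ h ≡ z → Pullback.P (pb z a) ⇒ Pullback.P (pb e a)
    liftMap a z e h eh =
      Pullback.pair (pb e a) (h ∘ Pullback.p₁ (pb z a)) (Pullback.p₂ (pb z a))
        (trans (sym assoc) (trans (cong (_∘ Pullback.p₁ (pb z a)) eh) (Pullback.commute (pb z a))))

    record LocalExp {C A Y} (a : A ⇒ C) (y : Y ⇒ C) : Set (o ⊔ ℓ) where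
      field
        E : Obj
        e : E ⇒ C
        ε : Pullback.P (pb e a) ⇒ Y
        ε-over : y ∘ ε ≡ e ∘ Pullback.p₁ (pb e a)
        universal : ∀ {Z} (z : Z ⇒ C) (g : Pullback.P (pb z a) ⇒ Y) →
          y ∘ g ≡ z ∘ Pullback.p₁ (pb z a) →
          Σ (Z ⇒ E) λ h → Σ (e ∘ h ≡ z) λ eh →
            (ε ∘ liftMap a z e h eh ≡ g) ×
            ((h' : Z ⇒ E) (eh' : e ∘ h' ≡ z) → ε ∘ liftMap a z e h' eh' ≡ g → h' ≡ h)

  record LCCC : Set (o ⊔ ℓ) where
    field
      ⊤ : Obj
      ⊤-terminal : IsTerminal ⊤
      pullback : PullbackChoice
      exponential : ∀ {C A Y} (a : A ⇒ C) (y : Y ⇒ C) → LocalExp pullback a y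

  -- (Closed) model structure; finite limits are supplied by the LCCC
  -- structure, finite colimits by the initial object and pushouts here.

  record ModelStructure (m : Level) : Set (o ⊔ ℓ ⊔ lsuc m) where
    field
      W Cof Fib : ∀ {A B} → A ⇒ B → Set m
      ∅ : Obj
      ∅-initial : IsInitial ∅
      pushout : ∀ {A B C} (f : C ⇒ A) (g : C ⇒ B) → Pushout f g
      W-∘ : ∀ {A B C} {f : A ⇒ B} {g : B ⇒ C} → W f → W g → W (g ∘ f)
      W-cancelˡ : ∀ {A B C} {f : A ⇒ B} {g : B ⇒ C} → W f → W (g ∘ f) → W g
      W-cancelʳ : ∀ {A B C} {f : A ⇒ B} {g : B ⇒ C} → W g → W (g ∘ f) → W f
      W-retract : ∀ {A B A' B'} {f : A ⇒ B} {g : A' ⇒ B'} → IsRetract f g → W g → W f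
      Cof-retract : ∀ {A B A' B'} {f : A ⇒ B} {g : A' ⇒ B'} → IsRetract f g → Cof g → Cof f
      Fib-retract : ∀ {A B A' B'} {f : A ⇒ B} {g : A' ⇒ B'} → IsRetract f g → Fib g → Fib f
      lift-TCof-Fib : ∀ {A B X Y} {i : A ⇒ B} {p : X ⇒ Y} → Cof i → W i → Fib p → Lifts i p
      lift-Cof-TFib : ∀ {A B X Y} {i : A ⇒ B} {p : X ⇒ Y} → Cof i → Fib p → W p → Lifts i p
      factor-TCof-Fib : ∀ {A B} (f : A ⇒ B) →
        Σ Obj λ M → Σ (A ⇒ M) λ g → Σ (M ⇒ B) λ h → (h ∘ g ≡ f) × Cof g × W g × Fib h
      factor-Cof-TFib : ∀ {A B} (f : A ⇒ B) →
        Σ Obj λ M → Σ (A ⇒ M) λ g → Σ (M ⇒ B) λ h → (h ∘ g ≡ f) × Cof g × Fib h × W h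

  module _ {m} (M : ModelStructure m) where
    open ModelStructure M

    RightProper : Set (o ⊔ ℓ ⊔ m)
    RightProper = ∀ {A B C P} (g : A ⇒ C) (w : B ⇒ C) (p₁ : P ⇒ A) (p₂ : P ⇒ B) →
      IsPullback g w p₁ p₂ → Fib g → W w → W p₁

  module LCCCOps (L : LCCC) where
    open LCCC L

    ! : (A : Obj) → A ⇒ ⊤
    ! A = proj₁ (⊤-terminal A)

    !-unique : ∀ {A} (u v : A ⇒ ⊤) → u ≡ v
    !-unique {A} u v = trans (proj₂ (⊤-terminal A) u) (sym (proj₂ (⊤-terminal A) v))

    infixr 7 _×₀_
    _×₀_ : Obj → Obj → Obj
    A ×₀ B = Pullback.P (pullback (! A) (! B))

    π₁ : ∀ {A B} → A ×₀ B ⇒ A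
    π₁ {A} {B} = Pullback.p₁ (pullback (! A) (! B))

    π₂ : ∀ {A B} → A ×₀ B ⇒ B
    π₂ {A} {B} = Pullback.p₂ (pullback (! A) (! B))

    ⟨_,_⟩ : ∀ {Z A B} → Z ⇒ A → Z ⇒ B → Z ⇒ A ×₀ B
    ⟨_,_⟩ {Z} {A} {B} h₁ h₂ = Pullback.pair (pullback (! A) (! B)) h₁ h₂ (!-unique _ _)

    infixr 8 _⊗_
    _⊗_ : ∀ {A B K L'} → A ⇒ B → K ⇒ L' → A ×₀ K ⇒ B ×₀ L'
    f ⊗ g = ⟨ f ∘ π₁ , g ∘ π₂ ⟩

    module _ {m} (M : ModelStructure m) where
      open ModelStructure M

      ¡ : (A : Obj) → ∅ ⇒ A
      ¡ A = proj₁ (∅-initial A)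

      ¡-unique : ∀ {A} (u v : ∅ ⇒ A) → u ≡ v
      ¡-unique {A} u v = trans (proj₂ (∅-initial A) u) (sym (proj₂ (∅-initial A) v))

      ⊤⊔⊤ : Pushout (¡ ⊤) (¡ ⊤)
      ⊤⊔⊤ = pushout (¡ ⊤) (¡ ⊤)

      endpoints : ∀ {I} (i₀ i₁ : ⊤ ⇒ I) → Pushout.Q ⊤⊔⊤ ⇒ I
      endpoints i₀ i₁ = Pushout.copair ⊤⊔⊤ i₀ i₁ (¡-unique _ _)

      -- the pushout-product of a cofibration with a trivial cofibration is a
      -- trivial cofibration.  (w is the pushout-product map i □ j out of any
      -- pushout of  A×L ← A×K → B×K.)
      PushoutProductAxiom : Set (o ⊔ ℓ ⊔ m)
      PushoutProductAxiom = ∀ {A B K L'} (i : A ⇒ B) (j : K ⇒ L') →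
        Cof i → Cof j → W j →
        ∀ {Q} (q₁ : A ×₀ L' ⇒ Q) (q₂ : B ×₀ K ⇒ Q) →
        IsPushout (id ⊗ j) (i ⊗ id) q₁ q₂ →
        (w : Q ⇒ B ×₀ L') → w ∘ q₁ ≡ i ⊗ id → w ∘ q₂ ≡ id ⊗ j →
        Cof w × W w

    -- Fibred path objects.  C × I → C is the projection; P^I_C(Y) is the
    -- local exponential [C × I , Y]_C.

    module PathObject (I : Obj) (i₀ i₁ : ⊤ ⇒ I)
                      {C X Y : Obj} (p : X ⇒ C) (q : Y ⇒ C)
                      (f : X ⇒ Y) (over : q ∘ f ≡ p) where

      CI : Obj
      CI = C ×₀ I

      sec : ⊤ ⇒ I → C ⇒ CI
      sec i = ⟨ id , i ∘ ! C ⟩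

      πC : CI ⇒ C
      πC = π₁ {C} {I}

      π₁∘sec : ∀ i → πC ∘ sec i ≡ id
      π₁∘sec i = Pullback.p₁∘pair (pullback (! C) (! I)) (!-unique _ _)

      PY : LocalExp pullback πC q
      PY = exponential πC q

      open LocalExp PY public using (E; e; ε; ε-over)

      EA : Pullback e πC
      EA = pullback e πC

      k : ⊤ ⇒ I → E ⇒ Pullback.P EA
      k i = Pullback.pair EA id (sec i ∘ e)
        (trans identityʳ (sym (trans (sym assoc) (trans (cong (_∘ e) (π₁∘sec i)) identityˡ))))

      evY : ⊤ ⇒ I → E ⇒ Y
      evY i = ε ∘ k i

      q∘evY : ∀ i → q ∘ evY i ≡ e
      q∘evY i =
        trans (sym assoc)
          (trans (cong (_∘ k i) ε-over)
            (trans assoc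
              (trans (cong (e ∘_) (Pullback.p₁∘pair EA _)) identityʳ)))

      YY : Pullback q q
      YY = pullback q q

      ev∂ : E ⇒ Pullback.P YY
      ev∂ = Pullback.pair YY (evY i₀) (evY i₁) (trans (q∘evY i₀) (sym (q∘evY i₁)))

      XY : Pullback p q
      XY = pullback p q

      f×Y : Pullback.P XY ⇒ Pullback.P YY
      f×Y = Pullback.pair YY (f ∘ Pullback.p₁ XY) (Pullback.p₂ XY)
        (trans (sym assoc) (trans (cong (_∘ Pullback.p₁ XY) over) (Pullback.commute XY)))

      Pf : Pullback ev∂ f×Y
      Pf = pullback ev∂ f×Y

      PIf : Obj
      PIf = Pullback.P Pf

      ev₀ : PIf ⇒ X
      ev₀ = Pullback.p₁ XY ∘ Pullback.p₂ Pf

      ev₁ : PIf ⇒ Y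
      ev₁ = Pullback.p₂ XY ∘ Pullback.p₂ Pf

{-# OPTIONS --safe #-}
-- A map Z → P^I_C(Y) = [C × I , Y]_C over C is the same as a homotopy Z × I → Y over C.
-- Under this transposition, lifting a map j against ev_∂ : P^I_C(Y) → Y ×_C Y (against
-- ev₀ : P^I_C(Y) → Y) becomes lifting the pushout-product of ∂I → I (of {0} → I) with j
-- against Y → C, where ∂I × B is B ⊔ B because − × B preserves coproducts.  By the
-- pushout-product axiom ev_∂ is therefore a fibration and ev₀ a trivial fibration.
-- Now ev₁ : P^I_C(f) → Y is a base change of ev_∂ followed by the base change X ×_C Y → Y
-- of X → C, hence a fibration.  Moreover ev₀ : P^I_C(f) → X is a base change of
-- ev₀ : P^I_C(Y) → Y, hence a trivial fibration, and the constant paths give a section s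
-- of it with ev₁ ∘ s = f; so ev₁ is a weak equivalence whenever f is, by two-out-of-three.
module Submission where

open import Defs
open import Level using (_⊔_)
open import Relation.Binary.PropositionalEquality
open import Data.Product using (Σ; _×_; _,_; proj₁; proj₂)

module CategoryLemmas {o ℓ} (𝒞 : Category o ℓ) where
  open Category 𝒞
  open CatDefs 𝒞

  pullˡ : ∀ {A B C D} {f : C ⇒ D} {g : B ⇒ C} {h : B ⇒ D} {k : A ⇒ B} →
          f ∘ g ≡ h → f ∘ (g ∘ k) ≡ h ∘ k
  pullˡ eq = trans (sym assoc) (cong (_∘ _) eq)

  pullʳ : ∀ {A B C D} {f : B ⇒ C} {g : A ⇒ B} {h : A ⇒ C} {k : C ⇒ D} →
          f ∘ g ≡ h → (k ∘ f) ∘ g ≡ k ∘ h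
  pullʳ eq = trans assoc (cong (_ ∘_) eq)

  extendˡ : ∀ {A B B′ C D} {f : A ⇒ B} {g : A ⇒ B′} {h : B ⇒ C} {i : B′ ⇒ C} {a : C ⇒ D} →
            h ∘ f ≡ i ∘ g → (a ∘ h) ∘ f ≡ (a ∘ i) ∘ g
  extendˡ eq = trans assoc (trans (cong (_ ∘_) eq) (sym assoc))

  extendʳ : ∀ {Z A B B′ C} {f : A ⇒ B} {g : A ⇒ B′} {h : B ⇒ C} {i : B′ ⇒ C} {a : Z ⇒ A} →
            h ∘ f ≡ i ∘ g → h ∘ (f ∘ a) ≡ i ∘ (g ∘ a)
  extendʳ eq = trans (sym assoc) (trans (cong (_∘ _) eq) assoc)

  cancelʳ : ∀ {A B C} {r : B ⇒ A} {s : A ⇒ B} {h : A ⇒ C} → r ∘ s ≡ id → (h ∘ r) ∘ s ≡ h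
  cancelʳ rs = trans (pullʳ rs) identityʳ

  retraction-epi : ∀ {A B C} {r : A ⇒ B} {s : B ⇒ A} {a b : B ⇒ C} →
                   r ∘ s ≡ id → a ∘ r ≡ b ∘ r → a ≡ b
  retraction-epi {s = s} rs eq =
    trans (sym (cancelʳ rs)) (trans (cong (_∘ s) eq) (cancelʳ rs))

  global-point-Mono : ∀ {T Z} → IsTerminal T → (t : T ⇒ Z) → Mono t
  global-point-Mono terminal t g h _ =
    trans (proj₂ (terminal _) g) (sym (proj₂ (terminal _) h))

  module PullbackUP {A B C P} {f : A ⇒ C} {g : B ⇒ C} {p₁ : P ⇒ A} {p₂ : P ⇒ B}
                    (pb : IsPullback f g p₁ p₂) where
    commute : f ∘ p₁ ≡ g ∘ p₂
    commute = proj₁ pb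

    pair : ∀ {Z} (h₁ : Z ⇒ A) (h₂ : Z ⇒ B) → f ∘ h₁ ≡ g ∘ h₂ → Z ⇒ P
    pair h₁ h₂ eq = proj₁ (proj₂ pb h₁ h₂ eq)

    p₁∘pair : ∀ {Z} {h₁ : Z ⇒ A} {h₂ : Z ⇒ B} (eq : f ∘ h₁ ≡ g ∘ h₂) → p₁ ∘ pair h₁ h₂ eq ≡ h₁
    p₁∘pair {h₁ = h₁} {h₂} eq = proj₁ (proj₁ (proj₂ (proj₂ pb h₁ h₂ eq)))

    p₂∘pair : ∀ {Z} {h₁ : Z ⇒ A} {h₂ : Z ⇒ B} (eq : f ∘ h₁ ≡ g ∘ h₂) → p₂ ∘ pair h₁ h₂ eq ≡ h₂
    p₂∘pair {h₁ = h₁} {h₂} eq = proj₂ (proj₁ (proj₂ (proj₂ pb h₁ h₂ eq)))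

    unique : ∀ {Z} {h₁ : Z ⇒ A} {h₂ : Z ⇒ B} (eq : f ∘ h₁ ≡ g ∘ h₂) (u : Z ⇒ P) →
             p₁ ∘ u ≡ h₁ → p₂ ∘ u ≡ h₂ → u ≡ pair h₁ h₂ eq
    unique {h₁ = h₁} {h₂} eq = proj₂ (proj₂ (proj₂ pb h₁ h₂ eq))

    ext : ∀ {Z} {u v : Z ⇒ P} → p₁ ∘ u ≡ p₁ ∘ v → p₂ ∘ u ≡ p₂ ∘ v → u ≡ v
    ext {u = u} {v} eq₁ eq₂ =
      trans (unique (extendʳ commute) u eq₁ eq₂) (sym (unique (extendʳ commute) v refl refl))

  module PushoutUP {A B C Q} {f : C ⇒ A} {g : C ⇒ B} {q₁ : A ⇒ Q} {q₂ : B ⇒ Q}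
                   (po : IsPushout f g q₁ q₂) where
    copair : ∀ {Z} (h₁ : A ⇒ Z) (h₂ : B ⇒ Z) → h₁ ∘ f ≡ h₂ ∘ g → Q ⇒ Z
    copair h₁ h₂ eq = proj₁ (proj₂ po h₁ h₂ eq)

    copair∘q₁ : ∀ {Z} {h₁ : A ⇒ Z} {h₂ : B ⇒ Z} (eq : h₁ ∘ f ≡ h₂ ∘ g) → copair h₁ h₂ eq ∘ q₁ ≡ h₁
    copair∘q₁ {h₁ = h₁} {h₂} eq = proj₁ (proj₁ (proj₂ (proj₂ po h₁ h₂ eq)))

    copair∘q₂ : ∀ {Z} {h₁ : A ⇒ Z} {h₂ : B ⇒ Z} (eq : h₁ ∘ f ≡ h₂ ∘ g) → copair h₁ h₂ eq ∘ q₂ ≡ h₂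
    copair∘q₂ {h₁ = h₁} {h₂} eq = proj₂ (proj₁ (proj₂ (proj₂ po h₁ h₂ eq)))

    unique : ∀ {Z} {h₁ : A ⇒ Z} {h₂ : B ⇒ Z} (eq : h₁ ∘ f ≡ h₂ ∘ g) (u : Q ⇒ Z) →
             u ∘ q₁ ≡ h₁ → u ∘ q₂ ≡ h₂ → u ≡ copair h₁ h₂ eq
    unique {h₁ = h₁} {h₂} eq = proj₂ (proj₂ (proj₂ po h₁ h₂ eq))

    ext : ∀ {Z} {u v : Q ⇒ Z} → u ∘ q₁ ≡ v ∘ q₁ → u ∘ q₂ ≡ v ∘ q₂ → u ≡ v
    ext {u = u} {v} eq₁ eq₂ =
      trans (unique (extendˡ (proj₁ po)) u eq₁ eq₂) (sym (unique (extendˡ (proj₁ po)) v refl refl))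

module Products {o ℓ} {𝒞 : Category o ℓ} (L : CatDefs.LCCC 𝒞) where
  open Category 𝒞
  open CatDefs 𝒞
  open LCCC L
  open LCCCOps L
  open CategoryLemmas 𝒞

  π₁∘⟨⟩ : ∀ {Z A B} {a : Z ⇒ A} {b : Z ⇒ B} → π₁ ∘ ⟨ a , b ⟩ ≡ a
  π₁∘⟨⟩ {A = A} {B} = Pullback.p₁∘pair (pullback (! A) (! B)) (!-unique _ _)

  π₂∘⟨⟩ : ∀ {Z A B} {a : Z ⇒ A} {b : Z ⇒ B} → π₂ ∘ ⟨ a , b ⟩ ≡ b
  π₂∘⟨⟩ {A = A} {B} = Pullback.p₂∘pair (pullback (! A) (! B)) (!-unique _ _)

  ⟨⟩-ext : ∀ {Z A B} {u v : Z ⇒ A ×₀ B} → π₁ ∘ u ≡ π₁ ∘ v → π₂ ∘ u ≡ π₂ ∘ v → u ≡ v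
  ⟨⟩-ext {A = A} {B} = PullbackUP.ext (Pullback.isPullback (pullback (! A) (! B)))

  ⟨⟩-unique : ∀ {Z A B} {a : Z ⇒ A} {b : Z ⇒ B} {u : Z ⇒ A ×₀ B} →
              π₁ ∘ u ≡ a → π₂ ∘ u ≡ b → u ≡ ⟨ a , b ⟩
  ⟨⟩-unique eq₁ eq₂ = ⟨⟩-ext (trans eq₁ (sym π₁∘⟨⟩)) (trans eq₂ (sym π₂∘⟨⟩))

  ⟨⟩∘ : ∀ {W Z A B} {a : Z ⇒ A} {b : Z ⇒ B} {h : W ⇒ Z} → ⟨ a , b ⟩ ∘ h ≡ ⟨ a ∘ h , b ∘ h ⟩
  ⟨⟩∘ = ⟨⟩-unique (pullˡ π₁∘⟨⟩) (pullˡ π₂∘⟨⟩)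

  π₁∘⊗ : ∀ {A B K L′} {f : A ⇒ B} {g : K ⇒ L′} → π₁ ∘ (f ⊗ g) ≡ f ∘ π₁
  π₁∘⊗ = π₁∘⟨⟩

  π₂∘⊗ : ∀ {A B K L′} {f : A ⇒ B} {g : K ⇒ L′} → π₂ ∘ (f ⊗ g) ≡ g ∘ π₂
  π₂∘⊗ = π₂∘⟨⟩

  ⊗∘⊗ : ∀ {A B D K L′ N} {f : B ⇒ D} {g : L′ ⇒ N} {f′ : A ⇒ B} {g′ : K ⇒ L′} →
        (f ⊗ g) ∘ (f′ ⊗ g′) ≡ (f ∘ f′) ⊗ (g ∘ g′)
  ⊗∘⊗ = ⟨⟩-unique (trans (pullˡ π₁∘⊗) (trans (pullʳ π₁∘⊗) (sym assoc)))
                  (trans (pullˡ π₂∘⊗) (trans (pullʳ π₂∘⊗) (sym assoc)))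

  ⊗id∘⊗id : ∀ {A B D K} {f : B ⇒ D} {g : A ⇒ B} → (f ⊗ id {K}) ∘ (g ⊗ id) ≡ (f ∘ g) ⊗ id
  ⊗id∘⊗id = trans ⊗∘⊗ (cong (_ ⊗_) identityˡ)

  ⊗-interchange : ∀ {A B K L′} {f : A ⇒ B} {g : K ⇒ L′} →
                  (f ⊗ id) ∘ (id ⊗ g) ≡ (id ⊗ g) ∘ (f ⊗ id)
  ⊗-interchange = trans ⊗∘⊗ (trans (cong₂ _⊗_ (trans identityʳ (sym identityˡ))
                                              (trans identityˡ (sym identityʳ)))
                                   (sym ⊗∘⊗))

  π₂∘⊗id : ∀ {A B K} {f : A ⇒ B} → π₂ ∘ (f ⊗ id {K}) ≡ π₂
  π₂∘⊗id = trans π₂∘⊗ identityˡ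

  π₁-epi : ∀ {Z V} {a b : Z ⇒ V} → a ∘ π₁ {Z} {⊤} ≡ b ∘ π₁ → a ≡ b
  π₁-epi = retraction-epi (π₁∘⟨⟩ {b = ! _})

  swap : ∀ {A B} → A ×₀ B ⇒ B ×₀ A
  swap = ⟨ π₂ , π₁ ⟩

  π₁∘swap : ∀ {A B} → π₁ ∘ swap {A} {B} ≡ π₂
  π₁∘swap = π₁∘⟨⟩

  π₂∘swap : ∀ {A B} → π₂ ∘ swap {A} {B} ≡ π₁
  π₂∘swap = π₂∘⟨⟩

  swap∘swap : ∀ {A B} → swap ∘ swap ≡ id {A ×₀ B}
  swap∘swap = ⟨⟩-ext (trans (pullˡ π₁∘swap) (trans π₂∘swap (sym identityʳ)))
                     (trans (pullˡ π₂∘swap) (trans π₁∘swap (sym identityʳ)))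

  swap∘⊗ : ∀ {A B K L′} {f : A ⇒ B} {g : K ⇒ L′} → swap ∘ (f ⊗ g) ≡ (g ⊗ f) ∘ swap
  swap∘⊗ = ⟨⟩-ext (trans (pullˡ π₁∘swap) (trans π₂∘⊗ (sym (trans (pullˡ π₁∘⊗) (pullʳ π₁∘swap)))))
                  (trans (pullˡ π₂∘swap) (trans π₁∘⊗ (sym (trans (pullˡ π₂∘⊗) (pullʳ π₂∘swap)))))

module Exponentials {o ℓ} {𝒞 : Category o ℓ} (L : CatDefs.LCCC 𝒞) where
  open Category 𝒞
  open CatDefs 𝒞
  open LCCC L
  open LCCCOps L
  open CategoryLemmas 𝒞
  open Products L
  open ≡-Reasoning

  -- Transposition for [C × K , Y]_C: maps Z → E over z : Z → C correspond to maps
  -- Z × K → Y over z ∘ π₁.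
  module Transpose {C K Y : Obj} (q : Y ⇒ C) where
    open LocalExp (exponential (π₁ {C} {K}) q) public using (E; e)
    open LocalExp (exponential (π₁ {C} {K}) q) using (ε; ε-over; universal)

    -- ψ z and φ z are the comparison isomorphisms between Z ×_C (C × K) and Z × K.
    ψ : ∀ {Z} (z : Z ⇒ C) → Pullback.P (pullback z π₁) ⇒ Z ×₀ K
    ψ z = ⟨ Pullback.p₁ (pullback z π₁) , π₂ ∘ Pullback.p₂ (pullback z π₁) ⟩

    φ : ∀ {Z} (z : Z ⇒ C) → Z ×₀ K ⇒ Pullback.P (pullback z π₁)
    φ z = Pullback.pair (pullback z π₁) π₁ ⟨ z ∘ π₁ , π₂ ⟩ (sym π₁∘⟨⟩)

    ψ∘φ : ∀ {Z} {z : Z ⇒ C} → ψ z ∘ φ z ≡ id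
    ψ∘φ {z = z} = ⟨⟩-ext (trans (pullˡ π₁∘⟨⟩) (trans (p₁∘pair _) (sym identityʳ)))
                         (trans (pullˡ π₂∘⟨⟩)
                                (trans (pullʳ (p₂∘pair _)) (trans π₂∘⟨⟩ (sym identityʳ))))
      where open Pullback (pullback z π₁)

    eval : E ×₀ K ⇒ Y
    eval = ε ∘ φ e

    uncurry : ∀ {Z} → Z ⇒ E → Z ×₀ K ⇒ Y
    uncurry γ = eval ∘ (γ ⊗ id)

    uncurry-natural : ∀ {Z W} (γ : Z ⇒ E) (s : W ⇒ Z) → uncurry γ ∘ (s ⊗ id) ≡ uncurry (γ ∘ s)
    uncurry-natural γ s = pullʳ ⊗id∘⊗id

    q∘uncurry : ∀ {Z} (γ : Z ⇒ E) → q ∘ uncurry γ ≡ (e ∘ γ) ∘ π₁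
    q∘uncurry γ = trans (pullˡ q∘eval) (extendˡ π₁∘⊗)
      where
        q∘eval : q ∘ eval ≡ e ∘ π₁
        q∘eval = trans (pullˡ ε-over) (pullʳ (Pullback.p₁∘pair (pullback e π₁) _))

    uncurry∘ψ : ∀ {Z} {z : Z ⇒ C} {γ : Z ⇒ E} (eγ : e ∘ γ ≡ z) →
                uncurry γ ∘ ψ z ≡ ε ∘ liftMap pullback π₁ z e γ eγ
    uncurry∘ψ {z = z} {γ} eγ = trans (trans assoc assoc) (cong (ε ∘_) (ext
      (begin
        p₁ ∘ (φ e ∘ ((γ ⊗ id) ∘ ψ z)) ≡⟨ pullˡ (p₁∘pair _) ⟩
        π₁ ∘ ((γ ⊗ id) ∘ ψ z)         ≡⟨ π₁∘γ⊗id∘ψ ⟩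
        γ ∘ pz.p₁                     ≡⟨ p₁∘pair _ ⟨
        p₁ ∘ liftMap pullback π₁ z e γ eγ ∎)
      (begin
        p₂ ∘ (φ e ∘ ((γ ⊗ id) ∘ ψ z))     ≡⟨ pullˡ (p₂∘pair _) ⟩
        ⟨ e ∘ π₁ , π₂ ⟩ ∘ ((γ ⊗ id) ∘ ψ z) ≡⟨ ⟨⟩-ext π₁-part π₂-part ⟩
        pz.p₂                             ≡⟨ p₂∘pair _ ⟨
        p₂ ∘ liftMap pullback π₁ z e γ eγ ∎)))
      where
        open Pullback (pullback e π₁)
        module pz = Pullback (pullback z π₁)
        open PullbackUP isPullback using (ext)
        π₁∘γ⊗id∘ψ : π₁ ∘ ((γ ⊗ id) ∘ ψ z) ≡ γ ∘ pz.p₁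
        π₁∘γ⊗id∘ψ = trans (pullˡ π₁∘⊗) (pullʳ π₁∘⟨⟩)
        π₁-part : π₁ ∘ (⟨ e ∘ π₁ , π₂ ⟩ ∘ ((γ ⊗ id) ∘ ψ z)) ≡ π₁ ∘ pz.p₂
        π₁-part = begin
          π₁ ∘ (⟨ e ∘ π₁ , π₂ ⟩ ∘ ((γ ⊗ id) ∘ ψ z)) ≡⟨ pullˡ π₁∘⟨⟩ ⟩
          (e ∘ π₁) ∘ ((γ ⊗ id) ∘ ψ z)             ≡⟨ pullʳ π₁∘γ⊗id∘ψ ⟩
          e ∘ (γ ∘ pz.p₁)                         ≡⟨ pullˡ eγ ⟩
          z ∘ pz.p₁                               ≡⟨ pz.commute ⟩
          π₁ ∘ pz.p₂ ∎
        π₂-part : π₂ ∘ (⟨ e ∘ π₁ , π₂ ⟩ ∘ ((γ ⊗ id) ∘ ψ z)) ≡ π₂ ∘ pz.p₂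
        π₂-part = trans (pullˡ π₂∘⟨⟩) (trans (pullˡ π₂∘⊗id) π₂∘⟨⟩)

    private
      over-ψ : ∀ {Z} {z : Z ⇒ C} {G : Z ×₀ K ⇒ Y} → q ∘ G ≡ z ∘ π₁ →
               q ∘ (G ∘ ψ z) ≡ z ∘ Pullback.p₁ (pullback z π₁)
      over-ψ qG = trans (pullˡ qG) (pullʳ π₁∘⟨⟩)

    curry : ∀ {Z} (z : Z ⇒ C) (G : Z ×₀ K ⇒ Y) → q ∘ G ≡ z ∘ π₁ → Z ⇒ E
    curry z G qG = proj₁ (universal z (G ∘ ψ z) (over-ψ qG))

    e∘curry : ∀ {Z} (z : Z ⇒ C) (G : Z ×₀ K ⇒ Y) (qG : q ∘ G ≡ z ∘ π₁) → e ∘ curry z G qG ≡ z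
    e∘curry z G qG = proj₁ (proj₂ (universal z (G ∘ ψ z) (over-ψ qG)))

    private
      ε∘liftMap∘curry : ∀ {Z} (z : Z ⇒ C) (G : Z ×₀ K ⇒ Y) (qG : q ∘ G ≡ z ∘ π₁) →
                        ε ∘ liftMap pullback π₁ z e (curry z G qG) (e∘curry z G qG) ≡ G ∘ ψ z
      ε∘liftMap∘curry z G qG = proj₁ (proj₂ (proj₂ (universal z (G ∘ ψ z) (over-ψ qG))))

    uncurry∘curry : ∀ {Z} (z : Z ⇒ C) (G : Z ×₀ K ⇒ Y) (qG : q ∘ G ≡ z ∘ π₁) →
                    uncurry (curry z G qG) ≡ G
    uncurry∘curry z G qG = begin
      uncurry (curry z G qG)               ≡⟨ cancelʳ ψ∘φ ⟨
      (uncurry (curry z G qG) ∘ ψ z) ∘ φ z ≡⟨ cong (_∘ φ z) (trans (uncurry∘ψ (e∘curry z G qG))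
                                                                   (ε∘liftMap∘curry z G qG)) ⟩
      (G ∘ ψ z) ∘ φ z                      ≡⟨ cancelʳ ψ∘φ ⟩
      G ∎

    curry-unique : ∀ {Z} (z : Z ⇒ C) (G : Z ×₀ K ⇒ Y) (qG : q ∘ G ≡ z ∘ π₁) (γ : Z ⇒ E) →
                   e ∘ γ ≡ z → uncurry γ ≡ G → γ ≡ curry z G qG
    curry-unique z G qG γ eγ uγ = proj₂ (proj₂ (proj₂ (universal z (G ∘ ψ z) (over-ψ qG))))
      γ eγ (trans (sym (uncurry∘ψ eγ)) (cong (_∘ ψ z) uγ))

    uncurry-injective : ∀ {Z} {γ γ′ : Z ⇒ E} → e ∘ γ ≡ e ∘ γ′ → uncurry γ ≡ uncurry γ′ → γ ≡ γ′
    uncurry-injective {γ = γ} {γ′} eγ≡eγ′ uγ≡uγ′ =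
      trans (curry-unique _ _ (q∘uncurry γ) γ refl refl)
            (sym (curry-unique _ _ (q∘uncurry γ) γ′ (sym eγ≡eγ′) (sym uγ≡uγ′)))

    uncurry-extension : ∀ {A B} {j : A ⇒ B} {c : B ⇒ C} (γ : A ⇒ E) (G : B ×₀ K ⇒ Y) →
      e ∘ γ ≡ c ∘ j → q ∘ G ≡ c ∘ π₁ → G ∘ (j ⊗ id) ≡ uncurry γ →
      Σ (B ⇒ E) λ δ → (δ ∘ j ≡ γ) × (uncurry δ ≡ G)
    uncurry-extension {B = B} {j} {c} γ G eγ qG Gj = δ , δ∘j≡γ , uncurry∘curry c G qG
      where
        δ : B ⇒ E
        δ = curry c G qG
        δ∘j≡γ : δ ∘ j ≡ γ
        δ∘j≡γ = uncurry-injective (trans (pullˡ (e∘curry c G qG)) (sym eγ)) (begin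
          uncurry (δ ∘ j)      ≡⟨ uncurry-natural δ j ⟨
          uncurry δ ∘ (j ⊗ id) ≡⟨ cong (_∘ (j ⊗ id)) (uncurry∘curry c G qG) ⟩
          G ∘ (j ⊗ id)         ≡⟨ Gj ⟩
          uncurry γ ∎)

module ModelLemmas {o ℓ m} {𝒞 : Category o ℓ} (M : CatDefs.ModelStructure 𝒞 m) where
  open Category 𝒞
  open CatDefs 𝒞
  open ModelStructure M
  open CategoryLemmas 𝒞

  TrivCof : ∀ {A B} → A ⇒ B → Set m
  TrivCof j = Cof j × W j

  RightLifts : (∀ {A B} → A ⇒ B → Set m) → ∀ {X Y} → X ⇒ Y → Set (o ⊔ ℓ ⊔ m)
  RightLifts S p = ∀ {A B} {j : A ⇒ B} → S j → Lifts j p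

  W-id : ∀ {A} → W (id {A})
  W-id = let (_ , _ , _ , _ , _ , W-g , _) = factor-TCof-Fib id
         in W-cancelʳ W-g (subst W (sym identityʳ) W-g)

  W-section : ∀ {A B} {r : A ⇒ B} {s : B ⇒ A} → W r → r ∘ s ≡ id → W s
  W-section W-r rs = W-cancelʳ W-r (subst W (sym rs) W-id)

  retract-argument : ∀ {A B N} {p : A ⇒ B} (g : A ⇒ N) (h : N ⇒ B) →
                     h ∘ g ≡ p → Lifts g p → IsRetract p h
  retract-argument g h h∘g≡p lifts =
    let (r , r∘g≡id , p∘r≡h) = lifts id h (trans identityʳ (sym h∘g≡p))
    in record { i = g ; r = r ; j = id ; s = id
              ; r∘i = r∘g≡id ; s∘j = identityˡ
              ; sq₁ = trans h∘g≡p (sym identityˡ) ; sq₂ = trans p∘r≡h (sym identityˡ) }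

  Fib⇒RightLifts-TrivCof : ∀ {X Y} {p : X ⇒ Y} → Fib p → RightLifts TrivCof p
  Fib⇒RightLifts-TrivCof Fib-p (Cof-j , W-j) = lift-TCof-Fib Cof-j W-j Fib-p

  RightLifts-TrivCof⇒Fib : ∀ {X Y} {p : X ⇒ Y} → RightLifts TrivCof p → Fib p
  RightLifts-TrivCof⇒Fib {p = p} lifts =
    let (_ , g , h , h∘g≡p , Cof-g , W-g , Fib-h) = factor-TCof-Fib p
    in Fib-retract (retract-argument g h h∘g≡p (lifts (Cof-g , W-g))) Fib-h

  RightLifts-Cof⇒W : ∀ {X Y} {p : X ⇒ Y} → RightLifts Cof p → W p
  RightLifts-Cof⇒W {p = p} lifts =
    let (_ , g , h , h∘g≡p , Cof-g , _ , W-h) = factor-Cof-TFib p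
    in W-retract (retract-argument g h h∘g≡p (lifts Cof-g)) W-h

  RightLifts-base-change : ∀ {S : ∀ {A B} → A ⇒ B → Set m} {A B C P}
    {f : A ⇒ C} {g : B ⇒ C} {p₁ : P ⇒ A} {p₂ : P ⇒ B} →
    IsPullback f g p₁ p₂ → RightLifts S f → RightLifts S p₂
  RightLifts-base-change {f = f} {g} {p₁} {p₂} pb f-lifts {j = j} S-j u v p₂∘u≡v∘j =
    let (d , d∘j≡p₁∘u , f∘d≡g∘v) = f-lifts S-j (p₁ ∘ u) (g ∘ v) square
    in pair d v f∘d≡g∘v ,
       ext (trans (pullˡ (p₁∘pair f∘d≡g∘v)) d∘j≡p₁∘u)
           (trans (pullˡ (p₂∘pair f∘d≡g∘v)) (sym p₂∘u≡v∘j)) ,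
       p₂∘pair f∘d≡g∘v
    where
      open PullbackUP pb
      square : f ∘ (p₁ ∘ u) ≡ (g ∘ v) ∘ j
      square = trans (extendʳ commute) (trans (cong (g ∘_) p₂∘u≡v∘j) (sym assoc))

  RightLifts-∘ : ∀ {S : ∀ {A B} → A ⇒ B → Set m} {X Y Z} {g : X ⇒ Y} {h : Y ⇒ Z} →
                 RightLifts S g → RightLifts S h → RightLifts S (h ∘ g)
  RightLifts-∘ {g = g} {h} g-lifts h-lifts S-j u v hg∘u≡v∘j =
    let (d₁ , d₁∘j≡g∘u , h∘d₁≡v) = h-lifts S-j (g ∘ u) v (trans (sym assoc) hg∘u≡v∘j)
        (d₂ , d₂∘j≡u , g∘d₂≡d₁) = g-lifts S-j u d₁ (sym d₁∘j≡g∘u)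
    in d₂ , d₂∘j≡u , trans (pullʳ g∘d₂≡d₁) h∘d₁≡v

module LCCCModel {o ℓ m} {𝒞 : Category o ℓ}
                 (L : CatDefs.LCCC 𝒞) (M : CatDefs.ModelStructure 𝒞 m) where
  open Category 𝒞
  open CatDefs 𝒞
  open LCCC L
  open LCCCOps L
  open ModelStructure M
  open CategoryLemmas 𝒞
  open Products L
  open Exponentials L
  open ModelLemmas M
  open ≡-Reasoning

  IsCoproduct : ∀ {A B Q} → A ⇒ Q → B ⇒ Q → Set (o ⊔ ℓ)
  IsCoproduct {A} {B} ι₁ ι₂ = IsPushout (¡ M A) (¡ M B) ι₁ ι₂

  module _ {A B Q} {ι₁ : A ⇒ Q} {ι₂ : B ⇒ Q} (coproduct : IsCoproduct ι₁ ι₂) {Z V : Obj} where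
    open PushoutUP coproduct
    open Transpose {K = Z} (! V)

    private
      transpose : ∀ {S} → S ×₀ Z ⇒ V → S ⇒ E
      transpose {S} H = curry (! S) H (!-unique _ _)

      uncurry∘transpose : ∀ {S} (H : S ×₀ Z ⇒ V) → uncurry (transpose H) ≡ H
      uncurry∘transpose {S} H = uncurry∘curry (! S) H (!-unique _ _)

    -- − × Z preserves coproducts, being left adjoint to [Z , −].
    ×-copair : A ×₀ Z ⇒ V → B ×₀ Z ⇒ V → Q ×₀ Z ⇒ V
    ×-copair h₁ h₂ = uncurry (copair (transpose h₁) (transpose h₂) (¡-unique M _ _))

    ×-copair∘ι₁ : ∀ {h₁ : A ×₀ Z ⇒ V} {h₂ : B ×₀ Z ⇒ V} → ×-copair h₁ h₂ ∘ (ι₁ ⊗ id) ≡ h₁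
    ×-copair∘ι₁ {h₁} = trans (uncurry-natural _ ι₁)
                             (trans (cong uncurry (copair∘q₁ _)) (uncurry∘transpose h₁))

    ×-copair∘ι₂ : ∀ {h₁ : A ×₀ Z ⇒ V} {h₂ : B ×₀ Z ⇒ V} → ×-copair h₁ h₂ ∘ (ι₂ ⊗ id) ≡ h₂
    ×-copair∘ι₂ {h₂ = h₂} = trans (uncurry-natural _ ι₂)
                                  (trans (cong uncurry (copair∘q₂ _)) (uncurry∘transpose h₂))

    ×-coproduct-ext : ∀ {H H′ : Q ×₀ Z ⇒ V} →
      H ∘ (ι₁ ⊗ id) ≡ H′ ∘ (ι₁ ⊗ id) → H ∘ (ι₂ ⊗ id) ≡ H′ ∘ (ι₂ ⊗ id) → H ≡ H′
    ×-coproduct-ext {H} {H′} eq₁ eq₂ = begin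
      H                      ≡⟨ uncurry∘transpose H ⟨
      uncurry (transpose H)  ≡⟨ cong uncurry (ext (agree eq₁) (agree eq₂)) ⟩
      uncurry (transpose H′) ≡⟨ uncurry∘transpose H′ ⟩
      H′ ∎
      where
        agree : ∀ {D} {ι : D ⇒ Q} → H ∘ (ι ⊗ id) ≡ H′ ∘ (ι ⊗ id) →
                transpose H ∘ ι ≡ transpose H′ ∘ ι
        agree {ι = ι} eq = uncurry-injective (!-unique _ _) (begin
          uncurry (transpose H ∘ ι)         ≡⟨ uncurry-natural _ ι ⟨
          uncurry (transpose H) ∘ (ι ⊗ id)  ≡⟨ cong (_∘ (ι ⊗ id)) (uncurry∘transpose H) ⟩
          H ∘ (ι ⊗ id)                      ≡⟨ eq ⟩
          H′ ∘ (ι ⊗ id)                     ≡⟨ cong (_∘ (ι ⊗ id)) (uncurry∘transpose H′) ⟨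
          uncurry (transpose H′) ∘ (ι ⊗ id) ≡⟨ uncurry-natural _ ι ⟩
          uncurry (transpose H′ ∘ ι) ∎)

  -- Opaque because unfolding the constructed filler makes elaborating its uses very slow.
  opaque
    pushout-product-lift : PushoutProductAxiom M →
      ∀ {A B K L′ Y C} {i : A ⇒ B} {j : K ⇒ L′} {q : Y ⇒ C} →
      Cof i → TrivCof j → Fib q →
      (h₁ : A ×₀ L′ ⇒ Y) (h₂ : B ×₀ K ⇒ Y) → h₁ ∘ (id ⊗ j) ≡ h₂ ∘ (i ⊗ id) →
      (b : B ×₀ L′ ⇒ C) → q ∘ h₁ ≡ b ∘ (i ⊗ id) → q ∘ h₂ ≡ b ∘ (id ⊗ j) →
      Σ (B ×₀ L′ ⇒ Y) λ G → (q ∘ G ≡ b) × (G ∘ (i ⊗ id) ≡ h₁) × (G ∘ (id ⊗ j) ≡ h₂)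
    pushout-product-lift ppa {B = B} {L′ = L′} {Y = Y} {i = i} {j} {q}
                         Cof-i (Cof-j , W-j) Fib-q h₁ h₂ h₁≈h₂ b qh₁ qh₂ =
      let (Cof-w , W-w) = ppa i j Cof-i Cof-j W-j q₁ q₂ isPushout w (copair∘q₁ _) (copair∘q₂ _)
          (G , G∘w≡h , q∘G≡b) = lift-TCof-Fib Cof-w W-w Fib-q h b square
      in G , q∘G≡b ,
         trans (cong (G ∘_) (sym (copair∘q₁ _))) (trans (pullˡ G∘w≡h) (copair∘q₁ h₁≈h₂)) ,
         trans (cong (G ∘_) (sym (copair∘q₂ _))) (trans (pullˡ G∘w≡h) (copair∘q₂ h₁≈h₂))
      where
        open Pushout (pushout (id ⊗ j) (i ⊗ id)) using (Q; q₁; q₂; isPushout)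
        open PushoutUP isPushout
        w : Q ⇒ B ×₀ L′
        w = copair (i ⊗ id) (id ⊗ j) ⊗-interchange
        h : Q ⇒ Y
        h = copair h₁ h₂ h₁≈h₂
        square : q ∘ h ≡ b ∘ w
        square = ext (trans (pullʳ (copair∘q₁ _)) (trans qh₁ (sym (pullʳ (copair∘q₁ _)))))
                     (trans (pullʳ (copair∘q₂ _)) (trans qh₂ (sym (pullʳ (copair∘q₂ _)))))

module FibredPaths {o ℓ m} {𝒞 : Category o ℓ} (L : CatDefs.LCCC 𝒞) (M : CatDefs.ModelStructure 𝒞 m)
                   (I : Category.Obj 𝒞) (i₀ i₁ : Category._⇒_ 𝒞 (CatDefs.LCCC.⊤ L) I)
                   {C X Y : Category.Obj 𝒞} (p : Category._⇒_ 𝒞 X C) (q : Category._⇒_ 𝒞 Y C)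
                   (f : Category._⇒_ 𝒞 X Y) (over : Category._∘_ 𝒞 q f ≡ p) where
  open Category 𝒞
  open CatDefs 𝒞
  open LCCC L
  open LCCCOps L
  open ModelStructure M
  open CategoryLemmas 𝒞
  open Products L
  open Exponentials L
  open ModelLemmas M
  open LCCCModel L M
  open PathObject I i₀ i₁ p q f over
  open Transpose {K = I} q
    using (φ; eval; uncurry; curry; uncurry∘curry; q∘uncurry; uncurry-extension)
  open Pushout (⊤⊔⊤ M) using () renaming (Q to ∂; q₁ to ι₀; q₂ to ι₁; isPushout to ∂-coproduct)
  open ≡-Reasoning
  private
    module XY = Pullback XY
    module YY = Pullback YY
    module Pf = Pullback Pf

  end : ∂ ⇒ I
  end = endpoints M i₀ i₁

  end∘ι₀ : end ∘ ι₀ ≡ i₀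
  end∘ι₀ = PushoutUP.copair∘q₁ ∂-coproduct _

  end∘ι₁ : end ∘ ι₁ ≡ i₁
  end∘ι₁ = PushoutUP.copair∘q₂ ∂-coproduct _

  e-from-evY : ∀ {i A B} {γ : A ⇒ E} {y : B ⇒ Y} {j : A ⇒ B} →
               evY i ∘ γ ≡ y ∘ j → e ∘ γ ≡ (q ∘ y) ∘ j
  e-from-evY {i} evγ≡yj = trans (sym (pullˡ (q∘evY i))) (trans (cong (q ∘_) evγ≡yj) (sym assoc))

  eval∘id⊗ : ∀ (i : ⊤ ⇒ I) → eval ∘ (id ⊗ i) ≡ evY i ∘ π₁
  eval∘id⊗ i = trans assoc (trans (cong (ε ∘_) φe∘id⊗i) (sym assoc))
    where
      open Pullback EA using (p₁; p₂; p₁∘pair; p₂∘pair; isPullback)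
      φe∘id⊗i : φ e ∘ (id ⊗ i) ≡ k i ∘ π₁
      φe∘id⊗i = PullbackUP.ext isPullback
        (begin
          p₁ ∘ (φ e ∘ (id ⊗ i)) ≡⟨ pullˡ (p₁∘pair _) ⟩
          π₁ ∘ (id ⊗ i)         ≡⟨ π₁∘⊗ ⟩
          id ∘ π₁               ≡⟨ pullˡ (p₁∘pair _) ⟨
          p₁ ∘ (k i ∘ π₁) ∎)
        (begin
          p₂ ∘ (φ e ∘ (id ⊗ i))                   ≡⟨ pullˡ (p₂∘pair _) ⟩
          ⟨ e ∘ π₁ , π₂ ⟩ ∘ (id ⊗ i)               ≡⟨ ⟨⟩∘ ⟩
          ⟨ (e ∘ π₁) ∘ (id ⊗ i) , π₂ ∘ (id ⊗ i) ⟩ ≡⟨ cong₂ ⟨_,_⟩ (extendˡ π₁∘⊗) π₂∘⊗ ⟩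
          ⟨ (e ∘ id) ∘ π₁ , i ∘ π₂ ⟩              ≡⟨ cong₂ ⟨_,_⟩
                                                       (trans (cong (_∘ π₁) identityʳ) (sym identityˡ))
                                                       (cong (i ∘_) (!-unique _ _)) ⟩
          ⟨ id ∘ (e ∘ π₁) , i ∘ (! C ∘ (e ∘ π₁)) ⟩ ≡⟨ cong ⟨ id ∘ (e ∘ π₁) ,_⟩ assoc ⟨
          ⟨ id ∘ (e ∘ π₁) , (i ∘ ! C) ∘ (e ∘ π₁) ⟩ ≡⟨ ⟨⟩∘ ⟨
          sec i ∘ (e ∘ π₁)                        ≡⟨ extendʳ (p₂∘pair _) ⟨
          p₂ ∘ (k i ∘ π₁) ∎)

  uncurry∘id⊗ : ∀ {Z} (γ : Z ⇒ E) (i : ⊤ ⇒ I) → uncurry γ ∘ (id ⊗ i) ≡ (evY i ∘ γ) ∘ π₁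
  uncurry∘id⊗ γ i = begin
    (eval ∘ (γ ⊗ id)) ∘ (id ⊗ i) ≡⟨ pullʳ ⊗-interchange ⟩
    eval ∘ ((id ⊗ i) ∘ (γ ⊗ id)) ≡⟨ pullˡ (eval∘id⊗ i) ⟩
    (evY i ∘ π₁) ∘ (γ ⊗ id)      ≡⟨ extendˡ π₁∘⊗ ⟩
    (evY i ∘ γ) ∘ π₁ ∎

  evY-from-uncurry : ∀ {Z} {δ : Z ⇒ E} {G : Z ×₀ I ⇒ Y} {i : ⊤ ⇒ I} {y : Z ⇒ Y} →
                     uncurry δ ≡ G → G ∘ (id ⊗ i) ≡ y ∘ π₁ → evY i ∘ δ ≡ y
  evY-from-uncurry {δ = δ} {i = i} uδ≡G G∘id⊗i≡yπ₁ =
    π₁-epi (trans (sym (uncurry∘id⊗ δ i)) (trans (cong (_∘ (id ⊗ i)) uδ≡G) G∘id⊗i≡yπ₁))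

  evY-i₀-lifts : PushoutProductAxiom M → TrivCof i₀ → Fib q → RightLifts Cof (evY i₀)
  evY-i₀-lifts ppa TrivCof-i₀ Fib-q {j = j} Cof-j γ y evγ≡yj =
    let (G , q∘G≡cπ₁ , G∘j⊗id , G∘id⊗i₀) =
          pushout-product-lift ppa Cof-j TrivCof-i₀ Fib-q (uncurry γ) (y ∘ π₁) compatible
                               ((q ∘ y) ∘ π₁) over-A×I over-B×⊤
        (δ , δ∘j≡γ , uδ≡G) = uncurry-extension γ G (e-from-evY evγ≡yj) q∘G≡cπ₁ G∘j⊗id
    in δ , δ∘j≡γ , evY-from-uncurry uδ≡G G∘id⊗i₀
    where
      compatible : uncurry γ ∘ (id ⊗ i₀) ≡ (y ∘ π₁) ∘ (j ⊗ id)
      compatible = trans (uncurry∘id⊗ γ i₀) (trans (cong (_∘ π₁) evγ≡yj) (sym (extendˡ π₁∘⊗)))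
      over-A×I : q ∘ uncurry γ ≡ ((q ∘ y) ∘ π₁) ∘ (j ⊗ id)
      over-A×I = trans (q∘uncurry γ) (trans (cong (_∘ π₁) (e-from-evY evγ≡yj)) (sym (extendˡ π₁∘⊗)))
      over-B×⊤ : q ∘ (y ∘ π₁) ≡ ((q ∘ y) ∘ π₁) ∘ (id ⊗ i₀)
      over-B×⊤ = trans (sym assoc) (sym (trans (extendˡ π₁∘⊗) (cong (_∘ π₁) identityʳ)))

  boundary : ∀ {B V} → B ⇒ V → B ⇒ V → ∂ ×₀ B ⇒ V
  boundary y₀ y₁ = ×-copair ∂-coproduct (y₀ ∘ π₂) (y₁ ∘ π₂)

  boundary∘ι₀ : ∀ {B V} (y₀ y₁ : B ⇒ V) → boundary y₀ y₁ ∘ (ι₀ ⊗ id) ≡ y₀ ∘ π₂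
  boundary∘ι₀ _ _ = ×-copair∘ι₁ ∂-coproduct

  boundary∘ι₁ : ∀ {B V} (y₀ y₁ : B ⇒ V) → boundary y₀ y₁ ∘ (ι₁ ⊗ id) ≡ y₁ ∘ π₂
  boundary∘ι₁ _ _ = ×-copair∘ι₂ ∂-coproduct

  uncurry∘swap∘⊗id : ∀ {Z} (γ : Z ⇒ E) (i : ⊤ ⇒ I) →
                     (uncurry γ ∘ swap) ∘ (i ⊗ id) ≡ (evY i ∘ γ) ∘ π₂
  uncurry∘swap∘⊗id γ i =
    trans (extendˡ swap∘⊗) (trans (cong (_∘ swap) (uncurry∘id⊗ γ i)) (pullʳ π₁∘swap))

  boundary-compatible : ∀ {A B} {j : A ⇒ B} (γ : A ⇒ E) (y₀ y₁ : B ⇒ Y) →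
    evY i₀ ∘ γ ≡ y₀ ∘ j → evY i₁ ∘ γ ≡ y₁ ∘ j →
    boundary y₀ y₁ ∘ (id ⊗ j) ≡ (uncurry γ ∘ swap) ∘ (end ⊗ id)
  boundary-compatible {j = j} γ y₀ y₁ ev₀γ ev₁γ =
    ×-coproduct-ext ∂-coproduct (at-endpoint end∘ι₀ (boundary∘ι₀ y₀ y₁) ev₀γ)
                                (at-endpoint end∘ι₁ (boundary∘ι₁ y₀ y₁) ev₁γ)
    where
      at-endpoint : ∀ {ι : ⊤ ⇒ ∂} {i : ⊤ ⇒ I} {y} → end ∘ ι ≡ i →
        boundary y₀ y₁ ∘ (ι ⊗ id) ≡ y ∘ π₂ → evY i ∘ γ ≡ y ∘ j →
        (boundary y₀ y₁ ∘ (id ⊗ j)) ∘ (ι ⊗ id) ≡ ((uncurry γ ∘ swap) ∘ (end ⊗ id)) ∘ (ι ⊗ id)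
      at-endpoint {ι} {i} {y} end∘ι≡i b∘ι evγ = begin
        (boundary y₀ y₁ ∘ (id ⊗ j)) ∘ (ι ⊗ id)         ≡⟨ pullʳ (sym ⊗-interchange) ⟩
        boundary y₀ y₁ ∘ ((ι ⊗ id) ∘ (id ⊗ j))         ≡⟨ pullˡ b∘ι ⟩
        (y ∘ π₂) ∘ (id ⊗ j)                            ≡⟨ extendˡ π₂∘⊗ ⟩
        (y ∘ j) ∘ π₂                                   ≡⟨ cong (_∘ π₂) evγ ⟨
        (evY i ∘ γ) ∘ π₂                               ≡⟨ uncurry∘swap∘⊗id γ i ⟨
        (uncurry γ ∘ swap) ∘ (i ⊗ id)                  ≡⟨ cong (λ t → _ ∘ (t ⊗ id)) end∘ι≡i ⟨
        (uncurry γ ∘ swap) ∘ ((end ∘ ι) ⊗ id)          ≡⟨ pullʳ ⊗id∘⊗id ⟨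
        ((uncurry γ ∘ swap) ∘ (end ⊗ id)) ∘ (ι ⊗ id) ∎

  q∘boundary : ∀ {B} {y₀ y₁ : B ⇒ Y} {c : B ⇒ C} → q ∘ y₀ ≡ c → q ∘ y₁ ≡ c →
               q ∘ boundary y₀ y₁ ≡ (c ∘ π₂) ∘ (end ⊗ id)
  q∘boundary {y₀ = y₀} {y₁} {c} qy₀ qy₁ =
    trans (×-coproduct-ext ∂-coproduct (at-endpoint (boundary∘ι₀ y₀ y₁) qy₀)
                                       (at-endpoint (boundary∘ι₁ y₀ y₁) qy₁))
          (sym (pullʳ π₂∘⊗id))
    where
      at-endpoint : ∀ {ι : ⊤ ⇒ ∂} {H y} → H ∘ (ι ⊗ id) ≡ y ∘ π₂ → q ∘ y ≡ c →
                    (q ∘ H) ∘ (ι ⊗ id) ≡ (c ∘ π₂) ∘ (ι ⊗ id)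
      at-endpoint H∘ι qy = trans (pullʳ H∘ι) (trans (pullˡ qy) (sym (pullʳ π₂∘⊗id)))

  path-extension-rel-∂ : PushoutProductAxiom M → Cof end → Fib q →
    ∀ {A B} {j : A ⇒ B} → TrivCof j → (γ : A ⇒ E) (y₀ y₁ : B ⇒ Y) → q ∘ y₀ ≡ q ∘ y₁ →
    evY i₀ ∘ γ ≡ y₀ ∘ j → evY i₁ ∘ γ ≡ y₁ ∘ j →
    Σ (B ⇒ E) λ δ → (δ ∘ j ≡ γ) × (evY i₀ ∘ δ ≡ y₀) × (evY i₁ ∘ δ ≡ y₁)
  path-extension-rel-∂ ppa Cof-end Fib-q {B = B} {j} TrivCof-j γ y₀ y₁ qy₀≡qy₁ ev₀γ ev₁γ =
    let (G , q∘G≡ , G∘end⊗id , G∘id⊗j) =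
          pushout-product-lift ppa Cof-end TrivCof-j Fib-q (boundary y₀ y₁) (uncurry γ ∘ swap)
            (boundary-compatible γ y₀ y₁ ev₀γ ev₁γ)
            ((q ∘ y₁) ∘ π₂) (q∘boundary qy₀≡qy₁ refl) over-I×A
        (δ , δ∘j≡γ , uδ≡G∘swap) = uncurry-extension γ (G ∘ swap) (e-from-evY ev₁γ)
          (trans (sym assoc) (trans (cong (_∘ swap) q∘G≡) (pullʳ π₂∘swap)))
          (trans (extendˡ swap∘⊗) (trans (cong (_∘ swap) G∘id⊗j) (cancelʳ swap∘swap)))
    in δ , δ∘j≡γ ,
       evY-from-uncurry uδ≡G∘swap (at-endpoint G∘end⊗id end∘ι₀ (boundary∘ι₀ y₀ y₁)) ,
       evY-from-uncurry uδ≡G∘swap (at-endpoint G∘end⊗id end∘ι₁ (boundary∘ι₁ y₀ y₁))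
    where
      over-I×A : q ∘ (uncurry γ ∘ swap) ≡ ((q ∘ y₁) ∘ π₂) ∘ (id ⊗ j)
      over-I×A = begin
        q ∘ (uncurry γ ∘ swap)      ≡⟨ pullˡ (q∘uncurry γ) ⟩
        ((e ∘ γ) ∘ π₁) ∘ swap       ≡⟨ pullʳ π₁∘swap ⟩
        (e ∘ γ) ∘ π₂                ≡⟨ cong (_∘ π₂) (e-from-evY ev₁γ) ⟩
        ((q ∘ y₁) ∘ j) ∘ π₂         ≡⟨ extendˡ π₂∘⊗ ⟨
        ((q ∘ y₁) ∘ π₂) ∘ (id ⊗ j) ∎
      at-endpoint : ∀ {G : I ×₀ B ⇒ Y} {ι : ⊤ ⇒ ∂} {i : ⊤ ⇒ I} {y} →
        G ∘ (end ⊗ id) ≡ boundary y₀ y₁ → end ∘ ι ≡ i → boundary y₀ y₁ ∘ (ι ⊗ id) ≡ y ∘ π₂ →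
        (G ∘ swap) ∘ (id ⊗ i) ≡ y ∘ π₁
      at-endpoint {G} {ι} {i} {y} G∘end⊗id end∘ι≡i b∘ι = begin
        (G ∘ swap) ∘ (id ⊗ i)                ≡⟨ extendˡ swap∘⊗ ⟩
        (G ∘ (i ⊗ id)) ∘ swap                ≡⟨ cong (λ t → (G ∘ (t ⊗ id)) ∘ swap) end∘ι≡i ⟨
        (G ∘ ((end ∘ ι) ⊗ id)) ∘ swap        ≡⟨ cong (_∘ swap) (pullʳ ⊗id∘⊗id) ⟨
        ((G ∘ (end ⊗ id)) ∘ (ι ⊗ id)) ∘ swap ≡⟨ cong (λ t → (t ∘ (ι ⊗ id)) ∘ swap) G∘end⊗id ⟩
        (boundary y₀ y₁ ∘ (ι ⊗ id)) ∘ swap   ≡⟨ cong (_∘ swap) b∘ι ⟩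
        (y ∘ π₂) ∘ swap                      ≡⟨ pullʳ π₂∘swap ⟩
        y ∘ π₁ ∎

  p₁∘ev∂ : YY.p₁ ∘ ev∂ ≡ evY i₀
  p₁∘ev∂ = YY.p₁∘pair (trans (q∘evY i₀) (sym (q∘evY i₁)))

  p₂∘ev∂ : YY.p₂ ∘ ev∂ ≡ evY i₁
  p₂∘ev∂ = YY.p₂∘pair (trans (q∘evY i₀) (sym (q∘evY i₁)))

  ev∂∘-from-endpoints : ∀ {B} {δ : B ⇒ E} {v : B ⇒ YY.P} →
                        evY i₀ ∘ δ ≡ YY.p₁ ∘ v → evY i₁ ∘ δ ≡ YY.p₂ ∘ v → ev∂ ∘ δ ≡ v
  ev∂∘-from-endpoints ev₀δ ev₁δ =
    PullbackUP.ext YY.isPullback (trans (pullˡ p₁∘ev∂) ev₀δ) (trans (pullˡ p₂∘ev∂) ev₁δ)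

  ev∂-lifts : PushoutProductAxiom M → Cof end → Fib q → RightLifts TrivCof ev∂
  ev∂-lifts ppa Cof-end Fib-q TrivCof-j γ v ev∂∘γ≡v∘j =
    let (δ , δ∘j≡γ , ev₀δ , ev₁δ) =
          path-extension-rel-∂ ppa Cof-end Fib-q TrivCof-j γ (YY.p₁ ∘ v) (YY.p₂ ∘ v)
            (extendʳ YY.commute)
            (trans (sym (pullˡ p₁∘ev∂)) (trans (cong (YY.p₁ ∘_) ev∂∘γ≡v∘j) (sym assoc)))
            (trans (sym (pullˡ p₂∘ev∂)) (trans (cong (YY.p₂ ∘_) ev∂∘γ≡v∘j) (sym assoc)))
    in δ , δ∘j≡γ , ev∂∘-from-endpoints {δ = δ} {v = v} ev₀δ ev₁δ

  path : PIf ⇒ E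
  path = Pf.p₁

  evY-i₀∘path : evY i₀ ∘ path ≡ f ∘ ev₀
  evY-i₀∘path = trans (cong (_∘ path) (sym p₁∘ev∂))
                      (trans (pullʳ Pf.commute) (trans (pullˡ (YY.p₁∘pair _)) assoc))

  evY-i₁∘path : evY i₁ ∘ path ≡ ev₁
  evY-i₁∘path = trans (cong (_∘ path) (sym p₂∘ev∂))
                      (trans (pullʳ Pf.commute) (pullˡ (YY.p₂∘pair _)))

  path-pair : ∀ {Z} (γ : Z ⇒ E) (x : Z ⇒ X) → evY i₀ ∘ γ ≡ f ∘ x → Z ⇒ PIf
  path-pair {Z} γ x ev₀γ≡fx = Pf.pair γ xy ev∂∘γ≡f×Y∘xy
    where
      px≡q∘ev₁γ : p ∘ x ≡ q ∘ (evY i₁ ∘ γ)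
      px≡q∘ev₁γ = begin
        p ∘ x              ≡⟨ pullˡ over ⟨
        q ∘ (f ∘ x)        ≡⟨ cong (q ∘_) ev₀γ≡fx ⟨
        q ∘ (evY i₀ ∘ γ)   ≡⟨ pullˡ (q∘evY i₀) ⟩
        e ∘ γ              ≡⟨ pullˡ (q∘evY i₁) ⟨
        q ∘ (evY i₁ ∘ γ) ∎
      xy : Z ⇒ XY.P
      xy = XY.pair x (evY i₁ ∘ γ) px≡q∘ev₁γ
      ev∂∘γ≡f×Y∘xy : ev∂ ∘ γ ≡ f×Y ∘ xy
      ev∂∘γ≡f×Y∘xy = PullbackUP.ext YY.isPullback
        (trans (pullˡ (YY.p₁∘pair _))
               (trans ev₀γ≡fx (sym (trans (pullˡ (YY.p₁∘pair _)) (pullʳ (XY.p₁∘pair _))))))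
        (trans (pullˡ (YY.p₂∘pair _)) (sym (trans (pullˡ (YY.p₂∘pair _)) (XY.p₂∘pair _))))

  path∘path-pair : ∀ {Z} (γ : Z ⇒ E) (x : Z ⇒ X) (ev₀γ≡fx : evY i₀ ∘ γ ≡ f ∘ x) →
                   path ∘ path-pair γ x ev₀γ≡fx ≡ γ
  path∘path-pair _ _ _ = Pf.p₁∘pair _

  ev₀∘path-pair : ∀ {Z} (γ : Z ⇒ E) (x : Z ⇒ X) (ev₀γ≡fx : evY i₀ ∘ γ ≡ f ∘ x) →
                  ev₀ ∘ path-pair γ x ev₀γ≡fx ≡ x
  ev₀∘path-pair _ _ _ = trans (pullʳ (Pf.p₂∘pair _)) (XY.p₁∘pair _)

  ev₁≡evY-i₁∘path : ∀ {Z} (u : Z ⇒ PIf) → ev₁ ∘ u ≡ evY i₁ ∘ (path ∘ u)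
  ev₁≡evY-i₁∘path u = trans (cong (_∘ u) (sym evY-i₁∘path)) assoc

  PIf-ext : ∀ {Z} {u v : Z ⇒ PIf} → path ∘ u ≡ path ∘ v → ev₀ ∘ u ≡ ev₀ ∘ v → u ≡ v
  PIf-ext {u = u} {v} path-eq ev₀-eq = PullbackUP.ext Pf.isPullback path-eq
    (PullbackUP.ext XY.isPullback
      (trans (sym assoc) (trans ev₀-eq assoc))
      (trans (sym assoc) (trans (ev₁≡evY-i₁∘path u)
        (trans (cong (evY i₁ ∘_) path-eq) (trans (sym (ev₁≡evY-i₁∘path v)) assoc)))))

  ev₀-isPullback : IsPullback (evY i₀) f path ev₀
  ev₀-isPullback = evY-i₀∘path , λ γ x ev₀γ≡fx →
    path-pair γ x ev₀γ≡fx , (path∘path-pair γ x ev₀γ≡fx , ev₀∘path-pair γ x ev₀γ≡fx) ,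
    λ u path∘u≡γ ev₀∘u≡x → PIf-ext (trans path∘u≡γ (sym (path∘path-pair γ x ev₀γ≡fx)))
                                   (trans ev₀∘u≡x (sym (ev₀∘path-pair γ x ev₀γ≡fx)))

  constant-path : ∀ {Z} → Z ⇒ Y → Z ⇒ E
  constant-path y = curry (q ∘ y) (y ∘ π₁) (sym assoc)

  evY∘constant-path : ∀ {Z} (y : Z ⇒ Y) (i : ⊤ ⇒ I) → evY i ∘ constant-path y ≡ y
  evY∘constant-path y i =
    evY-from-uncurry (uncurry∘curry (q ∘ y) (y ∘ π₁) (sym assoc))
                     (trans (pullʳ π₁∘⊗) (cong (y ∘_) identityˡ))

  private
    evY-i₀∘constant-path : evY i₀ ∘ constant-path f ≡ f ∘ id
    evY-i₀∘constant-path = trans (evY∘constant-path f i₀) (sym identityʳ)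

  reflexivity : X ⇒ PIf
  reflexivity = path-pair (constant-path f) id evY-i₀∘constant-path

  ev₀∘reflexivity : ev₀ ∘ reflexivity ≡ id
  ev₀∘reflexivity = ev₀∘path-pair (constant-path f) id evY-i₀∘constant-path

  ev₁∘reflexivity : ev₁ ∘ reflexivity ≡ f
  ev₁∘reflexivity = trans (ev₁≡evY-i₁∘path reflexivity)
    (trans (cong (evY i₁ ∘_) (path∘path-pair (constant-path f) id evY-i₀∘constant-path))
           (evY∘constant-path f i₁))

lemma6p11 : ∀ {o ℓ m} (𝒞 : Category o ℓ) (L : CatDefs.LCCC 𝒞)
    (M : CatDefs.ModelStructure 𝒞 m) →
    let open Category 𝒞
        open CatDefs 𝒞
        open LCCC L
        open LCCCOps L
        open ModelStructure M
    in
    -- cofibrations are exactly the monomorphisms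
    (∀ {A B} (g : A ⇒ B) → (Cof g → Mono g) × (Mono g → Cof g)) →
    -- pushout-product axiom
    PushoutProductAxiom M →
    -- I with disjoint endpoints, a good cylinder for the terminal object
    (I : Obj) (i₀ i₁ : ⊤ ⇒ I) →
    IsPullback i₀ i₁ (¡ M ⊤) (¡ M ⊤) →
    Cof (endpoints M i₀ i₁) →
    W (! I) →
    -- f : X → Y over C, with X → C and Y → C fibrant in 𝒞/C
    {C X Y : Obj} (p : X ⇒ C) (q : Y ⇒ C) (f : X ⇒ Y) (over : q ∘ f ≡ p) →
    Fib p → Fib q →
    Fib (PathObject.ev₁ I i₀ i₁ p q f over) ×
    (W f → RightProper M →
      Fib (PathObject.ev₁ I i₀ i₁ p q f over) × W (PathObject.ev₁ I i₀ i₁ p q f over))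
lemma6p11 𝒞 L M Cof⇔Mono ppa I i₀ i₁ _ Cof-end W-!I p q f over Fib-p Fib-q =
  Fib-ev₁ , λ W-f _ → Fib-ev₁ , W-ev₁ W-f
  where
    open Category 𝒞
    open CatDefs 𝒞
    open LCCC L
    open LCCCOps L
    open ModelStructure M
    open ModelLemmas M
    open PathObject I i₀ i₁ p q f over using (ev₀; ev₁; Pf; XY)
    open FibredPaths L M I i₀ i₁ p q f over

    Fib-ev₁ : Fib ev₁
    Fib-ev₁ = RightLifts-TrivCof⇒Fib (RightLifts-∘
      (RightLifts-base-change (Pullback.isPullback Pf) (ev∂-lifts ppa Cof-end Fib-q))
      (RightLifts-base-change (Pullback.isPullback XY) (Fib⇒RightLifts-TrivCof Fib-p)))

    TrivCof-i₀ : TrivCof i₀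
    TrivCof-i₀ = proj₂ (Cof⇔Mono i₀) (CategoryLemmas.global-point-Mono 𝒞 ⊤-terminal i₀) ,
                 W-section W-!I (!-unique _ _)

    W-ev₀ : W ev₀
    W-ev₀ = RightLifts-Cof⇒W
      (RightLifts-base-change ev₀-isPullback (evY-i₀-lifts ppa TrivCof-i₀ Fib-q))

    W-ev₁ : W f → W ev₁
    W-ev₁ W-f = W-cancelˡ (W-section W-ev₀ ev₀∘reflexivity) (subst W (sym ev₁∘reflexivity) W-f)
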